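{- Let $\alpha=(\alpha_1,\ldots,\alpha_{2s})$ be a composition of $n$ with an even number of parts and let $\beta=(\alpha_2,\ldots,\alpha_{2s},\alpha_1)$ be its cyclic shift by one step. Then the rank sequence of $\overline{F}(\beta)$ is the reverse of that of $\overline{F}(\alpha)$: if $\overline{R}(\alpha;q)=\sum_{k=0}^n r_kq^k$ then $\overline{R}(\beta;q)=\sum_{k=0}^n r_{n-k}q^k$. In particular, for every $k\in\mathbb{N}$, the polynomial $\overline{R}((k,1,1,\ldots,1);q)$, where the number of parts is even, is symmetric.
   Context: A composition of $n$ is a sequence of positive integers summing to $n$. For a composition $\alpha=(\alpha_1,\ldots,\alpha_{2s})$ of $n$ with an even number of parts, the fence poset $F(\alpha)$ is the poset on $x_1,\ldots,x_{n+1}$ generated by $x_1\preceq\cdots\preceq x_{\alpha_1+1}\succeq\cdots\succeq x_{\alpha_1+\alpha_2+1}\preceq\cdots$ (first $\alpha_1$ steps up, next $\alpha_2$ down, alternately), and the circular fence poset $\overline{F}(\alpha)$ is the poset on $n$ elements obtained from these relations by identifying $x_{n+1}$ with $x_1$. $\overline{R}(\alpha;q)=\sum_I q^{|I|}$, summed over all lower order ideals $I$ of $\overline{F}(\alpha)$. A polynomial $\sum_{k=0}^n c_kq^k$ is symmetric if $c_k=c_{n-k}$ for all $k$. -}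

module Defs where

open import Data.Bool using (Bool; true; false; not; if_then_else_)
import Data.Nat
open import Data.Nat using (ℕ; zero; suc; _<ᵇ_; _∸_; _≟_; _%_)
open import Data.Nat.DivMod using (m%n<n)
open import Data.Nat.ListAction using (sum)
open import Data.List using (List; []; _∷_; length; filter; map; _++_)
open import Data.Vec using (Vec; []; _∷_)
open import Data.Fin using (Fin; toℕ; fromℕ<)
open import Data.Fin.Subset using (Subset; _∈_; ∣_∣; inside; outside)
open import Data.Fin.Subset.Properties using (_∈?_)
open import Data.Fin.Properties using (all?)
open import Data.Product using (_×_; _,_)
open import Relation.Binary.PropositionalEquality using (_≡_; refl)
open import Relation.Binary.Construct.Closure.ReflexiveTransitive using (Star; ε; _◅_)
open import Relation.Nullary using (Dec; yes; no)
open import Relation.Nullary.Decidable using (map′; _×-dec_; _→-dec_)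

-- Direction of the step from x_{m+1} to x_{m+2} (0-based step index m) in
-- the fence of the composition α: true = up (x_{m+1} ≼ x_{m+2}),
-- false = down.
up? : List ℕ → ℕ → Bool
up? []       m = true
up? (a ∷ as) m = if m <ᵇ a then true else not (up? as (m ∸ a))

nextF : ∀ {N} → Fin N → Fin N
nextF {suc k} i = fromℕ< (m%n<n (suc (toℕ i)) (suc k))

-- Generating (cover) relations of the circular fence poset F̄(α),
-- on the n = sum α elements x_1,…,x_n (represented by Fin n).
data Cov (α : List ℕ) : Fin (sum α) → Fin (sum α) → Set where
  step-up   : ∀ i → up? α (toℕ i) ≡ true  → Cov α i (nextF i)
  step-down : ∀ i → up? α (toℕ i) ≡ false → Cov α (nextF i) i

Leq : (α : List ℕ) → Fin (sum α) → Fin (sum α) → Set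
Leq α = Star (Cov α)

IsLowerIdeal : (α : List ℕ) → Subset (sum α) → Set
IsLowerIdeal α I = ∀ x y → Leq α x y → y ∈ I → x ∈ I

private
  EdgeCond : ∀ {N} → Bool → Subset N → Fin N → Set
  EdgeCond true  I i = nextF i ∈ I → i ∈ I
  EdgeCond false I i = i ∈ I → nextF i ∈ I

  edgeCond? : ∀ {N} b (I : Subset N) i → Dec (EdgeCond b I i)
  edgeCond? true  I i = (nextF i ∈? I) →-dec (i ∈? I)
  edgeCond? false I i = (i ∈? I) →-dec (nextF i ∈? I)

  EdgesOK : (α : List ℕ) → Subset (sum α) → Set
  EdgesOK α I = ∀ i → EdgeCond (up? α (toℕ i)) I i

  fromEdges : ∀ α I → EdgesOK α I → IsLowerIdeal α I
  fromEdges α I ok x .x ε y∈ = y∈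
  fromEdges α I ok x y (step-up .x e ◅ r) y∈ with up? α (toℕ x) | ok x
  ... | true | h = h (fromEdges α I ok _ y r y∈)
  fromEdges α I ok _ y (step-down i e ◅ r) y∈ with up? α (toℕ i) | ok i
  ... | false | h = h (fromEdges α I ok _ y r y∈)

  toEdges : ∀ α I → IsLowerIdeal α I → EdgesOK α I
  toEdges α I id i with up? α (toℕ i) in e
  ... | true  = λ n∈ → id i (nextF i) (step-up i e ◅ ε) n∈
  ... | false = λ i∈ → id (nextF i) i (step-down i e ◅ ε) i∈

isLowerIdeal? : ∀ α I → Dec (IsLowerIdeal α I)
isLowerIdeal? α I =
  map′ (fromEdges α I) (toEdges α I) (all? (λ i → edgeCond? (up? α (toℕ i)) I i))

allSubsets : ∀ N → List (Subset N)
allSubsets zero    = [] ∷ []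
allSubsets (suc N) = map (outside ∷_) (allSubsets N) ++ map (inside ∷_) (allSubsets N)

-- r_k: the coefficient of q^k in R̄(α;q), i.e. the number of lower
-- order ideals of F̄(α) with exactly k elements.
rankCoeff : List ℕ → ℕ → ℕ
rankCoeff α k =
  length (filter (λ I → isLowerIdeal? α I ×-dec (∣ I ∣ ≟ k)) (allSubsets (sum α)))

IsSymmetricRank : List ℕ → Set
IsSymmetricRank α = ∀ k → k Data.Nat.≤ sum α → rankCoeff α k ≡ rankCoeff α (sum α ∸ k)

-- Being a lower ideal of a circular fence is a conjunction of one condition per edge, so the
-- rank numbers depend only on the cyclic sequence of edge orientations. Rotating the cycle
-- preserves them; complementing an ideal reverses every edge and sends size k to n − k;
-- reflecting the cycle reverses the order of the edges as well as each edge. Shifting an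
-- even composition by one step turns its orientation into the complement of a rotation,
-- which reverses the rank sequence. The composition (k, 1, …, 1) with an odd number of ones
-- is, as a list, the reversal of its own shift, so its rank sequence equals its reverse.
module Submission where

open import Defs
open import Data.Bool using (Bool; true; false; not; T)
open import Data.Bool.Properties using (not-involutive) renaming (_≟_ to _≟ᵇ_)
open import Data.Empty using (⊥)
open import Data.Fin using (Fin; zero; suc; toℕ; fromℕ; inject₁; opposite)
open import Data.Fin.Properties
  using (all?; toℕ-injective; toℕ-fromℕ<; toℕ-fromℕ; toℕ-inject₁; toℕ<n; opposite-prop; opposite-involutive)
open import Data.Fin.Relation.Unary.Top using (view; ‵fromℕ; ‵inj₁)
open import Data.Fin.Subset using (Subset; ∣_∣; ∁; inside; outside)
open import Data.Fin.Subset.Properties using (∣∁p∣≡n∸∣p∣)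
open import Data.List using (List; []; _∷_; _++_; _∷ʳ_; length; replicate; reverse; filter; map)
open import Data.List.Properties using (length-map; length-replicate; length-reverse; unfold-reverse)
open import Data.List.Relation.Unary.All using (All; []; _∷_)
open import Data.List.Relation.Unary.Any using (here)
open import Data.List.Relation.Unary.Unique.Propositional using (Unique; []; _∷_)
import Data.List.Relation.Unary.Unique.Propositional.Properties as Unique
open import Data.List.Membership.Propositional using () renaming (_∈_ to _∈ₗ_)
open import Data.List.Membership.Propositional.Properties
  using (∈-map⁺; ∈-map⁻; ∈-++⁺ˡ; ∈-++⁺ʳ; ∈-filter⁺; ∈-filter⁻)
open import Data.List.Membership.Propositional.Properties.WithK using (unique∧set⇒bag)
open import Data.List.Relation.Binary.BagAndSetEquality using (∼bag⇒↭)
open import Data.List.Relation.Binary.Permutation.Propositional.Properties using (↭-length; ↭-reverse; ∷↭∷ʳ)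
open import Data.Nat using (ℕ; zero; suc; _+_; _*_; _∸_; _≤_; _<_; _≟_; _%_; _<ᵇ_; NonZero; s≤s)
import Data.Nat.Properties as ℕ
open import Data.Nat.DivMod using (m<n⇒m%n≡m; n%n≡0; [m+n]%n≡m%n; %-distribˡ-+; m%n%n≡m%n)
open import Data.Nat.ListAction using (sum)
open import Data.Nat.ListAction.Properties using (sum-↭)
open import Data.Product using (_×_; _,_; proj₂; ∃)
open import Data.Vec using (Vec; []; _∷_; lookup; init; last; initLast)
  renaming (_∷ʳ_ to _∷ʳᵥ_; reverse to reverseᵥ)
open import Data.Vec.Properties
  using (∷-injectiveʳ; lookup-map; lookup⇒[]=; []=⇒lookup; init-∷ʳ; last-∷ʳ; reverse-∷; reverse-involutive)
open import Function using (_∘_)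
open import Function.Bundles using (mk⇔)
open import Relation.Binary.PropositionalEquality
open import Relation.Nullary using (Dec; yes; no; contradiction)
open import Relation.Nullary.Decidable using (_×-dec_; _→-dec_)
open import Relation.Unary using (Decidable)
open import Relation.Binary.Construct.Closure.ReflexiveTransitive using (ε; _◅_)

open ≡-Reasoning

private
  variable
    A : Set
    N M : ℕ

allSubsets-unique : ∀ N → Unique (allSubsets N)
allSubsets-unique zero    = [] ∷ []
allSubsets-unique (suc N) = Unique.++⁺ (Unique.map⁺ ∷-injectiveʳ u) (Unique.map⁺ ∷-injectiveʳ u) disjoint
  where
  u = allSubsets-unique N
  disjoint : ∀ {I} → I ∈ₗ map (outside ∷_) (allSubsets N) × I ∈ₗ map (inside ∷_) (allSubsets N) → ⊥
  disjoint (p , q) with ∈-map⁻ (outside ∷_) p | ∈-map⁻ (inside ∷_) q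
  ... | _ , _ , refl | _ , _ , ()

∈-allSubsets : (I : Subset N) → I ∈ₗ allSubsets N
∈-allSubsets []                   = here refl
∈-allSubsets (false ∷ I)          = ∈-++⁺ˡ (∈-map⁺ (outside ∷_) (∈-allSubsets I))
∈-allSubsets {suc N} (true ∷ I)   = ∈-++⁺ʳ (map (outside ∷_) (allSubsets N)) (∈-map⁺ (inside ∷_) (∈-allSubsets I))

countSubsets : {P : Subset N → Set} → Decidable P → ℕ
countSubsets {N} P? = length (filter P? (allSubsets N))

countSubsets-bijection : {P Q : Subset N → Set} (P? : Decidable P) (Q? : Decidable Q)
  (f g : Subset N → Subset N) → (∀ I → g (f I) ≡ I) → (∀ J → f (g J) ≡ J) →
  (∀ I → P I → Q (f I)) → (∀ J → Q J → P (g J)) → countSubsets P? ≡ countSubsets Q?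
countSubsets-bijection {N} P? Q? f g gf fg P⇒Q Q⇒P = begin
  length Ps           ≡⟨ length-map f Ps ⟨
  length (map f Ps)   ≡⟨ ↭-length (∼bag⇒↭ (unique∧set⇒bag fPs-unique Qs-unique (mk⇔ to from))) ⟩
  length Qs           ∎
  where
  Ps = filter P? (allSubsets N)
  Qs = filter Q? (allSubsets N)
  f-injective : ∀ {I J} → f I ≡ f J → I ≡ J
  f-injective {I} {J} e = trans (sym (gf I)) (trans (cong g e) (gf J))
  fPs-unique = Unique.map⁺ f-injective (Unique.filter⁺ P? (allSubsets-unique N))
  Qs-unique  = Unique.filter⁺ Q? (allSubsets-unique N)
  to : ∀ {J} → J ∈ₗ map f Ps → J ∈ₗ Qs
  to J∈ with ∈-map⁻ f J∈
  ... | I , I∈ , refl = ∈-filter⁺ Q? (∈-allSubsets _) (P⇒Q I (proj₂ (∈-filter⁻ P? {xs = allSubsets N} I∈)))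
  from : ∀ {J} → J ∈ₗ Qs → J ∈ₗ map f Ps
  from {J} J∈ = subst (_∈ₗ map f Ps) (fg J)
    (∈-map⁺ f (∈-filter⁺ P? (∈-allSubsets _) (Q⇒P J (proj₂ (∈-filter⁻ Q? {xs = allSubsets N} J∈)))))

-- An orientation D : Fin N → Bool says whether the edge from i to nextF i goes up (true)
-- or down (false); Closed is the ideal condition across that edge, in terms of the
-- memberships x of i and y of nextF i.
Closed : Bool → Bool → Bool → Set
Closed true  x y = y ≡ true → x ≡ true
Closed false x y = x ≡ true → y ≡ true

closed? : ∀ b x y → Dec (Closed b x y)
closed? true  x y = (y ≟ᵇ true) →-dec (x ≟ᵇ true)
closed? false x y = (x ≟ᵇ true) →-dec (y ≟ᵇ true)

IsIdeal : (Fin N → Bool) → Subset N → Set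
IsIdeal D I = ∀ i → Closed (D i) (lookup I i) (lookup I (nextF i))

isIdeal? : (D : Fin N → Bool) → Decidable (IsIdeal D)
isIdeal? D I = all? (λ i → closed? (D i) _ _)

idealCount : (Fin N → Bool) → ℕ → ℕ
idealCount D k = countSubsets (λ I → isIdeal? D I ×-dec (∣ I ∣ ≟ k))

idealCount-bijection : (D D′ : Fin N → Bool) (k k′ : ℕ) (f g : Subset N → Subset N) →
  (∀ I → g (f I) ≡ I) → (∀ J → f (g J) ≡ J) →
  (∀ I → IsIdeal D I → IsIdeal D′ (f I)) → (∀ I → ∣ I ∣ ≡ k → ∣ f I ∣ ≡ k′) →
  (∀ J → IsIdeal D′ J → IsIdeal D (g J)) → (∀ J → ∣ J ∣ ≡ k′ → ∣ g J ∣ ≡ k) →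
  idealCount D k ≡ idealCount D′ k′
idealCount-bijection D D′ k k′ f g gf fg fD fk gD gk =
  countSubsets-bijection _ _ f g gf fg (λ I (ideal , size) → fD I ideal , fk I size) (λ J (ideal , size) → gD J ideal , gk J size)

isIdeal-cong : {D D′ : Fin N → Bool} → (∀ i → D i ≡ D′ i) → ∀ {I} → IsIdeal D I → IsIdeal D′ I
isIdeal-cong D≗D′ {I} I-ideal i = subst (λ b → Closed b (lookup I i) (lookup I (nextF i))) (D≗D′ i) (I-ideal i)

idealCount-cong : {D D′ : Fin N → Bool} → (∀ i → D i ≡ D′ i) → ∀ k → idealCount D k ≡ idealCount D′ k
idealCount-cong D≗D′ k = idealCount-bijection _ _ k k (λ I → I) (λ J → J) (λ _ → refl) (λ _ → refl)
  (λ I → isIdeal-cong D≗D′ {I}) (λ _ e → e) (λ J → isIdeal-cong (λ i → sym (D≗D′ i)) {J}) (λ _ e → e)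

idealCount-cast : ∀ {N N′} → N ≡ N′ → (f : ℕ → Bool) (k : ℕ) →
  idealCount {N} (f ∘ toℕ) k ≡ idealCount {N′} (f ∘ toℕ) k
idealCount-cast refl f k = refl

orientation : (α : List ℕ) → Fin (sum α) → Bool
orientation α i = up? α (toℕ i)

rankCoeff≡idealCount : ∀ α k → rankCoeff α k ≡ idealCount (orientation α) k
rankCoeff≡idealCount α k =
  countSubsets-bijection (λ I → isLowerIdeal? α I ×-dec (∣ I ∣ ≟ k)) (λ I → isIdeal? (orientation α) I ×-dec (∣ I ∣ ≟ k))
    (λ I → I) (λ J → J) (λ _ → refl) (λ _ → refl)
  (λ I (ideal , size) → lowerIdeal⇒isIdeal I ideal , size) (λ J (ideal , size) → isIdeal⇒lowerIdeal J ideal , size)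
  where
  lowerIdeal⇒isIdeal : ∀ I → IsLowerIdeal α I → IsIdeal (orientation α) I
  lowerIdeal⇒isIdeal I I-ideal i with up? α (toℕ i) in e
  ... | true  = λ next∈ → []=⇒lookup (I-ideal i (nextF i) (step-up i e ◅ ε) (lookup⇒[]= _ _ next∈))
  ... | false = λ i∈ → []=⇒lookup (I-ideal (nextF i) i (step-down i e ◅ ε) (lookup⇒[]= _ _ i∈))
  isIdeal⇒lowerIdeal : ∀ I → IsIdeal (orientation α) I → IsLowerIdeal α I
  isIdeal⇒lowerIdeal I I-ideal x .x ε y∈ = y∈
  isIdeal⇒lowerIdeal I I-ideal x y (step-up .x e ◅ x≤y) y∈ with up? α (toℕ x) | I-ideal x
  ... | true | closed = lookup⇒[]= _ _ (closed ([]=⇒lookup (isIdeal⇒lowerIdeal I I-ideal _ y x≤y y∈)))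
  isIdeal⇒lowerIdeal I I-ideal _ y (step-down i e ◅ x≤y) y∈ with up? α (toℕ i) | I-ideal i
  ... | false | closed = lookup⇒[]= _ _ (closed ([]=⇒lookup (isIdeal⇒lowerIdeal I I-ideal _ y x≤y y∈)))

not-contrapositive : ∀ {x y} → (x ≡ true → y ≡ true) → not y ≡ true → not x ≡ true
not-contrapositive {true}  {true}  _ ()
not-contrapositive {true}  {false} x⇒y _ = x⇒y refl
not-contrapositive {false}         _ _ = refl

closed-not : ∀ b x y → Closed b x y → Closed (not b) (not x) (not y)
closed-not true  x y = not-contrapositive
closed-not false x y = not-contrapositive

∁-involutive : (I : Subset N) → ∁ (∁ I) ≡ I
∁-involutive []      = refl
∁-involutive (x ∷ I) = cong₂ _∷_ (not-involutive x) (∁-involutive I)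

∁-isIdeal : {D : Fin N → Bool} (I : Subset N) → IsIdeal D I → IsIdeal (not ∘ D) (∁ I)
∁-isIdeal I I-ideal i rewrite lookup-map i not I | lookup-map (nextF i) not I = closed-not _ _ _ (I-ideal i)

idealCount-∁ : (D : Fin N → Bool) {k : ℕ} → k ≤ N → idealCount (not ∘ D) k ≡ idealCount D (N ∸ k)
idealCount-∁ {N} D {k} k≤N = idealCount-bijection (not ∘ D) D k (N ∸ k) ∁ ∁ ∁-involutive ∁-involutive
  (λ I ideal → isIdeal-cong (not-involutive ∘ D) {∁ I} (∁-isIdeal I ideal))
  (λ I size → trans (∣∁p∣≡n∸∣p∣ I) (cong (N ∸_) size))
  ∁-isIdeal
  (λ J size → trans (∣∁p∣≡n∸∣p∣ J) (trans (cong (N ∸_) size) (ℕ.m∸[m∸n]≡n k≤N)))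

[1+m%n]%n≡[1+m]%n : ∀ m n .{{_ : NonZero n}} → suc (m % n) % n ≡ suc m % n
[1+m%n]%n≡[1+m]%n m n = begin
  (1 + m % n) % n            ≡⟨ %-distribˡ-+ 1 (m % n) n ⟩
  (1 % n + m % n % n) % n    ≡⟨ cong (λ r → (1 % n + r) % n) (m%n%n≡m%n m n) ⟩
  (1 % n + m % n) % n        ≡⟨ %-distribˡ-+ 1 m n ⟨
  (1 + m) % n                ∎

toℕ-nextF : (i : Fin (suc M)) → toℕ (nextF i) ≡ suc (toℕ i) % suc M
toℕ-nextF i = toℕ-fromℕ< _

nextF-inject₁ : (j : Fin M) → nextF (inject₁ j) ≡ suc j
nextF-inject₁ {M} j = toℕ-injective (begin
  toℕ (nextF (inject₁ j))          ≡⟨ toℕ-nextF (inject₁ j) ⟩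
  suc (toℕ (inject₁ j)) % suc M    ≡⟨ cong (λ m → suc m % suc M) (toℕ-inject₁ j) ⟩
  suc (toℕ j) % suc M              ≡⟨ m<n⇒m%n≡m (s≤s (toℕ<n j)) ⟩
  suc (toℕ j)                      ∎)

nextF-fromℕ : ∀ M → nextF (fromℕ M) ≡ zero
nextF-fromℕ M = toℕ-injective (begin
  toℕ (nextF (fromℕ M))          ≡⟨ toℕ-nextF (fromℕ M) ⟩
  suc (toℕ (fromℕ M)) % suc M    ≡⟨ cong (λ m → suc m % suc M) (toℕ-fromℕ M) ⟩
  suc M % suc M                  ≡⟨ n%n≡0 (suc M) ⟩
  0                              ∎)

nextF-surjective : (i : Fin (suc M)) → ∃ λ j → nextF j ≡ i
nextF-surjective {M} zero = fromℕ M , nextF-fromℕ M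
nextF-surjective (suc j)  = inject₁ j , nextF-inject₁ j

nextFⁿ : ℕ → Fin N → Fin N
nextFⁿ zero    i = i
nextFⁿ (suc j) i = nextF (nextFⁿ j i)

toℕ-nextFⁿ : ∀ j (i : Fin (suc M)) → toℕ (nextFⁿ j i) ≡ (toℕ i + j) % suc M
toℕ-nextFⁿ {M} zero i = begin
  toℕ i                ≡⟨ m<n⇒m%n≡m (toℕ<n i) ⟨
  toℕ i % suc M        ≡⟨ cong (_% suc M) (ℕ.+-identityʳ (toℕ i)) ⟨
  (toℕ i + 0) % suc M  ∎
toℕ-nextFⁿ {M} (suc j) i = begin
  toℕ (nextF (nextFⁿ j i))          ≡⟨ toℕ-nextF (nextFⁿ j i) ⟩
  suc (toℕ (nextFⁿ j i)) % suc M    ≡⟨ cong (λ m → suc m % suc M) (toℕ-nextFⁿ j i) ⟩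
  suc ((toℕ i + j) % suc M) % suc M ≡⟨ [1+m%n]%n≡[1+m]%n (toℕ i + j) (suc M) ⟩
  suc (toℕ i + j) % suc M           ≡⟨ cong (_% suc M) (ℕ.+-suc (toℕ i) j) ⟨
  (toℕ i + suc j) % suc M           ∎

lookup-∷ʳ-inject₁ : ∀ {n} (xs : Vec A n) x (j : Fin n) → lookup (xs ∷ʳᵥ x) (inject₁ j) ≡ lookup xs j
lookup-∷ʳ-inject₁ (y ∷ ys) x zero    = refl
lookup-∷ʳ-inject₁ (y ∷ ys) x (suc j) = lookup-∷ʳ-inject₁ ys x j

lookup-∷ʳ-fromℕ : ∀ {n} (xs : Vec A n) x → lookup (xs ∷ʳᵥ x) (fromℕ n) ≡ x
lookup-∷ʳ-fromℕ []       x = refl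
lookup-∷ʳ-fromℕ (y ∷ ys) x = lookup-∷ʳ-fromℕ ys x

rotate : ∀ {n} → Vec A (suc n) → Vec A (suc n)
rotate (x ∷ xs) = xs ∷ʳᵥ x

unrotate : ∀ {n} → Vec A (suc n) → Vec A (suc n)
unrotate v = last v ∷ init v

unrotate-rotate : ∀ {n} (v : Vec A (suc n)) → unrotate (rotate v) ≡ v
unrotate-rotate (x ∷ xs) = cong₂ _∷_ (last-∷ʳ x xs) (init-∷ʳ x xs)

rotate-unrotate : ∀ {n} (v : Vec A (suc n)) → rotate (unrotate v) ≡ v
rotate-unrotate v = sym (proj₂ (proj₂ (initLast v)))

lookup-rotate : (v : Vec A (suc M)) (i : Fin (suc M)) → lookup (rotate v) i ≡ lookup v (nextF i)
lookup-rotate {M = M} (x ∷ xs) i with view i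
... | ‵fromℕ rewrite nextF-fromℕ M = lookup-∷ʳ-fromℕ xs x
... | ‵inj₁ {i = j} _ rewrite nextF-inject₁ j = lookup-∷ʳ-inject₁ xs x j

lookup-unrotate-nextF : (v : Vec A (suc M)) (j : Fin (suc M)) → lookup (unrotate v) (nextF j) ≡ lookup v j
lookup-unrotate-nextF v j = trans (sym (lookup-rotate (unrotate v) j)) (cong (λ w → lookup w j) (rotate-unrotate v))

∣∷∣-cong : ∀ x {p q : Subset N} → ∣ p ∣ ≡ ∣ q ∣ → ∣ x ∷ p ∣ ≡ ∣ x ∷ q ∣
∣∷∣-cong true  = cong suc
∣∷∣-cong false = λ e → e

∣∷∷∣-comm : ∀ x y (p : Subset N) → ∣ x ∷ y ∷ p ∣ ≡ ∣ y ∷ x ∷ p ∣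
∣∷∷∣-comm true  true  p = refl
∣∷∷∣-comm true  false p = refl
∣∷∷∣-comm false true  p = refl
∣∷∷∣-comm false false p = refl

∣∷ʳ∣ : (p : Subset N) (x : Bool) → ∣ p ∷ʳᵥ x ∣ ≡ ∣ x ∷ p ∣
∣∷ʳ∣ []      x = refl
∣∷ʳ∣ (y ∷ p) x = trans (∣∷∣-cong y {p ∷ʳᵥ x} {x ∷ p} (∣∷ʳ∣ p x)) (∣∷∷∣-comm y x p)

rotate-isIdeal : {D : Fin (suc M) → Bool} (I : Subset (suc M)) → IsIdeal D I → IsIdeal (D ∘ nextF) (rotate I)
rotate-isIdeal I I-ideal i rewrite lookup-rotate I i | lookup-rotate I (nextF i) = I-ideal (nextF i)

unrotate-isIdeal : {D : Fin (suc M) → Bool} (J : Subset (suc M)) → IsIdeal (D ∘ nextF) J → IsIdeal D (unrotate J)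
unrotate-isIdeal J J-ideal i with nextF-surjective i
... | j , refl rewrite lookup-unrotate-nextF J j | lookup-unrotate-nextF J (nextF j) = J-ideal j

idealCount-rotate : (D : Fin (suc M) → Bool) (k : ℕ) → idealCount D k ≡ idealCount (D ∘ nextF) k
idealCount-rotate D k = idealCount-bijection D (D ∘ nextF) k k rotate unrotate unrotate-rotate rotate-unrotate
  rotate-isIdeal (λ { (x ∷ p) size → trans (∣∷ʳ∣ p x) size })
  unrotate-isIdeal (λ J size → trans (sym (∣∷ʳ∣ (init J) (last J))) (trans (cong ∣_∣ (rotate-unrotate J)) size))

idealCount-rotateⁿ : ∀ j (D : Fin (suc M) → Bool) (k : ℕ) → idealCount D k ≡ idealCount (D ∘ nextFⁿ j) k
idealCount-rotateⁿ zero    D k = refl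
idealCount-rotateⁿ (suc j) D k = trans (idealCount-rotate D k) (idealCount-rotateⁿ j (D ∘ nextF) k)

opposite-inject₁ : ∀ {n} (j : Fin n) → opposite (inject₁ j) ≡ suc (opposite j)
opposite-inject₁ zero    = refl
opposite-inject₁ (suc j) = cong inject₁ (opposite-inject₁ j)

opposite-fromℕ : ∀ n → opposite (fromℕ n) ≡ zero
opposite-fromℕ zero    = refl
opposite-fromℕ (suc n) = cong inject₁ (opposite-fromℕ n)

nextF-opposite-nextF : (i : Fin (suc M)) → nextF (opposite (nextF i)) ≡ opposite i
nextF-opposite-nextF {M} i with view i
... | ‵fromℕ rewrite nextF-fromℕ M = trans (nextF-fromℕ M) (sym (opposite-fromℕ M))
... | ‵inj₁ {i = j} _ rewrite nextF-inject₁ j = trans (nextF-inject₁ (opposite j)) (sym (opposite-inject₁ j))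

lookup-reverse : ∀ {n} (xs : Vec A n) (i : Fin n) → lookup (reverseᵥ xs) i ≡ lookup xs (opposite i)
lookup-reverse {n = suc n} (x ∷ xs) i rewrite reverse-∷ x xs with view i
... | ‵fromℕ rewrite opposite-fromℕ n = lookup-∷ʳ-fromℕ (reverseᵥ xs) x
... | ‵inj₁ {i = j} _ rewrite opposite-inject₁ j = trans (lookup-∷ʳ-inject₁ (reverseᵥ xs) x j) (lookup-reverse xs j)

∣reverse∣ : (p : Subset N) → ∣ reverseᵥ p ∣ ≡ ∣ p ∣
∣reverse∣ []      = refl
∣reverse∣ (x ∷ p) rewrite reverse-∷ x p =
  trans (∣∷ʳ∣ (reverseᵥ p) x) (∣∷∣-cong x {reverseᵥ p} {p} (∣reverse∣ p))

closed-swap : ∀ b x y → Closed b x y → Closed (not b) y x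
closed-swap true  x y c = c
closed-swap false x y c = c

reflectOrientation : (Fin (suc M) → Bool) → Fin (suc M) → Bool
reflectOrientation D i = not (D (opposite (nextF i)))

reflectOrientation-involutive : (D : Fin (suc M) → Bool) (i : Fin (suc M)) →
  reflectOrientation (reflectOrientation D) i ≡ D i
reflectOrientation-involutive D i = begin
  not (not (D (opposite (nextF (opposite (nextF i))))))  ≡⟨ not-involutive _ ⟩
  D (opposite (nextF (opposite (nextF i))))              ≡⟨ cong (D ∘ opposite) (nextF-opposite-nextF i) ⟩
  D (opposite (opposite i))                              ≡⟨ cong D (opposite-involutive i) ⟩
  D i                                                    ∎

reverse-isIdeal : {D : Fin (suc M) → Bool} (I : Subset (suc M)) → IsIdeal D I →
  IsIdeal (reflectOrientation D) (reverseᵥ I)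
reverse-isIdeal {D = D} I I-ideal i
  rewrite lookup-reverse I i | lookup-reverse I (nextF i) | sym (nextF-opposite-nextF i) =
  closed-swap (D (opposite (nextF i))) _ _ (I-ideal (opposite (nextF i)))

idealCount-reflect : (D : Fin N → Bool) (k : ℕ) → idealCount D k ≡ idealCount (not ∘ D ∘ opposite) k
idealCount-reflect {zero}  D k = idealCount-cong {D = D} {D′ = not ∘ D ∘ opposite} (λ ()) k
idealCount-reflect {suc M} D k = begin
  idealCount D k                          ≡⟨ idealCount-bijection D (reflectOrientation D) k k
                                               reverseᵥ reverseᵥ reverse-involutive reverse-involutive
                                               reverse-isIdeal (λ I size → trans (∣reverse∣ I) size)
                                               reflect-back (λ J size → trans (∣reverse∣ J) size) ⟩
  idealCount (reflectOrientation D) k     ≡⟨ idealCount-rotate (not ∘ D ∘ opposite) k ⟨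
  idealCount (not ∘ D ∘ opposite) k       ∎
  where
  reflect-back : ∀ J → IsIdeal (reflectOrientation D) J → IsIdeal D (reverseᵥ J)
  reflect-back J J-ideal = isIdeal-cong (reflectOrientation-involutive D) {reverseᵥ J} (reverse-isIdeal J J-ideal)

not^ : ℕ → Bool → Bool
not^ zero    b = b
not^ (suc n) b = not (not^ n b)

not^-not : ∀ n b → not^ n (not b) ≡ not (not^ n b)
not^-not zero    b = refl
not^-not (suc n) b = cong not (not^-not n b)

not^-even : ∀ {n} s b → n ≡ 2 * s → not^ n b ≡ b
not^-even zero    b refl = refl
not^-even (suc s) b refl = begin
  not^ (2 * suc s) b           ≡⟨ cong (λ n → not^ n b) (ℕ.*-suc 2 s) ⟩
  not (not (not^ (2 * s) b))   ≡⟨ not-involutive _ ⟩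
  not^ (2 * s) b               ≡⟨ not^-even s b refl ⟩
  b                            ∎

up?-< : ∀ a as {m} → m < a → up? (a ∷ as) m ≡ true
up?-< a as {m} m<a with m <ᵇ a | ℕ.<⇒<ᵇ m<a
... | true | _ = refl

up?-≥ : ∀ a as {m} → a ≤ m → up? (a ∷ as) m ≡ not (up? as (m ∸ a))
up?-≥ a as {m} a≤m with m <ᵇ a in m<ᵇa
... | false = refl
... | true  = contradiction (ℕ.<ᵇ⇒< m a (subst T (sym m<ᵇa) _)) (ℕ.≤⇒≯ a≤m)

up?-+ : ∀ a as m → up? (a ∷ as) (a + m) ≡ not (up? as m)
up?-+ a as m = trans (up?-≥ a as (ℕ.m≤m+n a m)) (cong (not ∘ up? as) (ℕ.m+n∸m≡n a m))

up?-++ˡ : ∀ xs ys {m} → m < sum xs → up? (xs ++ ys) m ≡ up? xs m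
up?-++ˡ (x ∷ xs) ys {m} m<sum with m <ᵇ x in m<ᵇx
... | true  = refl
... | false = cong not (up?-++ˡ xs ys m∸x<sum)
  where
  x≤m : x ≤ m
  x≤m = ℕ.≮⇒≥ (λ m<x → subst T m<ᵇx (ℕ.<⇒<ᵇ m<x))
  m∸x<sum : m ∸ x < sum xs
  m∸x<sum = subst (m ∸ x <_) (ℕ.m+n∸m≡n x (sum xs)) (ℕ.∸-monoˡ-< m<sum x≤m)

up?-++ʳ : ∀ xs ys {m} → sum xs ≤ m → up? (xs ++ ys) m ≡ not^ (length xs) (up? ys (m ∸ sum xs))
up?-++ʳ []       ys         sum≤m = refl
up?-++ʳ (x ∷ xs) ys {m} sum≤m = begin
  up? (x ∷ xs ++ ys) m                                  ≡⟨ up?-≥ x (xs ++ ys) (ℕ.m+n≤o⇒m≤o x sum≤m) ⟩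
  not (up? (xs ++ ys) (m ∸ x))                          ≡⟨ cong not (up?-++ʳ xs ys sum≤m∸x) ⟩
  not (not^ (length xs) (up? ys (m ∸ x ∸ sum xs)))      ≡⟨ cong (λ n → not (not^ (length xs) (up? ys n)))
                                                             (ℕ.∸-+-assoc m x (sum xs)) ⟩
  not (not^ (length xs) (up? ys (m ∸ (x + sum xs))))    ∎
  where
  sum≤m∸x : sum xs ≤ m ∸ x
  sum≤m∸x = ℕ.m+n≤o⇒m≤o∸n (sum xs) (subst (_≤ m) (ℕ.+-comm x (sum xs)) sum≤m)

up?-rotate : ∀ a as {s m} .{{_ : NonZero (a + sum as)}} → suc (length as) ≡ 2 * s → m < a + sum as →
  up? (as ∷ʳ a) m ≡ not (up? (a ∷ as) ((m + a) % (a + sum as)))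
up?-rotate a as {s} {m} even m<n with m ℕ.<? sum as
... | yes m<sum = begin
  up? (as ∷ʳ a) m                          ≡⟨ up?-++ˡ as (a ∷ []) m<sum ⟩
  up? as m                                 ≡⟨ not-involutive _ ⟨
  not (not (up? as m))                     ≡⟨ cong not (up?-+ a as m) ⟨
  not (up? (a ∷ as) (a + m))               ≡⟨ cong (not ∘ up? (a ∷ as)) m+a%n≡a+m ⟨
  not (up? (a ∷ as) ((m + a) % n))         ∎
  where
  n = a + sum as
  m+a%n≡a+m : (m + a) % n ≡ a + m
  m+a%n≡a+m = trans (m<n⇒m%n≡m (subst (m + a <_) (ℕ.+-comm (sum as) a) (ℕ.+-monoˡ-< a m<sum))) (ℕ.+-comm m a)
... | no m≮sum = begin
  up? (as ∷ʳ a) m                             ≡⟨ up?-++ʳ as (a ∷ []) sum≤m ⟩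
  not^ (length as) (up? (a ∷ []) (m ∸ sum as)) ≡⟨ cong (not^ (length as)) (up?-< a [] m∸sum<a) ⟩
  not^ (length as) true                       ≡⟨ not-involutive _ ⟨
  not (not^ (suc (length as)) true)           ≡⟨ cong not (not^-even s true even) ⟩
  not true                                    ≡⟨ cong not (up?-< a as m∸sum<a) ⟨
  not (up? (a ∷ as) (m ∸ sum as))             ≡⟨ cong (not ∘ up? (a ∷ as)) m+a%n≡m∸sum ⟨
  not (up? (a ∷ as) ((m + a) % n))            ∎
  where
  n = a + sum as
  sum≤m : sum as ≤ m
  sum≤m = ℕ.≮⇒≥ m≮sum
  m∸sum<a : m ∸ sum as < a
  m∸sum<a = subst (m ∸ sum as <_) (ℕ.m+n∸n≡m a (sum as)) (ℕ.∸-monoˡ-< m<n sum≤m)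
  m+a≡m∸sum+n : m + a ≡ (m ∸ sum as) + n
  m+a≡m∸sum+n = begin
    m + a                          ≡⟨ cong (_+ a) (ℕ.m∸n+n≡m sum≤m) ⟨
    (m ∸ sum as) + sum as + a      ≡⟨ ℕ.+-assoc (m ∸ sum as) (sum as) a ⟩
    (m ∸ sum as) + (sum as + a)    ≡⟨ cong ((m ∸ sum as) +_) (ℕ.+-comm (sum as) a) ⟩
    (m ∸ sum as) + n               ∎
  m+a%n≡m∸sum : (m + a) % n ≡ m ∸ sum as
  m+a%n≡m∸sum = begin
    (m + a) % n                ≡⟨ cong (_% n) m+a≡m∸sum+n ⟩
    ((m ∸ sum as) + n) % n     ≡⟨ [m+n]%n≡m%n (m ∸ sum as) n ⟩
    (m ∸ sum as) % n           ≡⟨ m<n⇒m%n≡m (ℕ.<-≤-trans m∸sum<a (ℕ.m≤m+n a (sum as))) ⟩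
    m ∸ sum as                 ∎

sum-reverse : (xs : List ℕ) → sum (reverse xs) ≡ sum xs
sum-reverse xs = sum-↭ (↭-reverse xs)

up?-reverse : ∀ γ {m} → m < sum γ → up? (reverse γ) m ≡ not^ (suc (length γ)) (up? γ (sum γ ∸ suc m))
up?-reverse (x ∷ xs) {m} m<n rewrite unfold-reverse x xs with m ℕ.<? sum xs
... | yes m<sum = begin
  up? (reverse xs ∷ʳ x) m                              ≡⟨ up?-++ˡ (reverse xs) (x ∷ []) (subst (m <_) (sym (sum-reverse xs)) m<sum) ⟩
  up? (reverse xs) m                                   ≡⟨ up?-reverse xs m<sum ⟩
  not^ (suc (length xs)) y                             ≡⟨ not-involutive _ ⟨
  not (not (not^ (suc (length xs)) y))                 ≡⟨ cong not (not^-not (suc (length xs)) y) ⟨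
  not^ (suc (suc (length xs))) (not y)                 ≡⟨ cong (not^ (suc (suc (length xs)))) (up?-+ x xs (sum xs ∸ suc m)) ⟨
  not^ (suc (suc (length xs))) (up? (x ∷ xs) (x + (sum xs ∸ suc m)))
                                                       ≡⟨ cong (not^ (suc (suc (length xs))) ∘ up? (x ∷ xs)) (ℕ.+-∸-assoc x m<sum) ⟨
  not^ (suc (suc (length xs))) (up? (x ∷ xs) (x + sum xs ∸ suc m)) ∎
  where
  y = up? xs (sum xs ∸ suc m)
... | no m≮sum = begin
  up? (reverse xs ∷ʳ x) m                              ≡⟨ up?-++ʳ (reverse xs) (x ∷ []) (subst (_≤ m) (sym (sum-reverse xs)) sum≤m) ⟩
  not^ (length (reverse xs)) (up? (x ∷ []) (m ∸ sum (reverse xs)))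
                                                       ≡⟨ cong₂ not^ (length-reverse xs) (up?-< x [] m∸sum<x) ⟩
  not^ (length xs) true                                ≡⟨ not-involutive _ ⟨
  not^ (suc (suc (length xs))) true                    ≡⟨ cong (not^ (suc (suc (length xs)))) (up?-< x xs n∸suc-m<x) ⟨
  not^ (suc (suc (length xs))) (up? (x ∷ xs) (x + sum xs ∸ suc m)) ∎
  where
  sum≤m : sum xs ≤ m
  sum≤m = ℕ.≮⇒≥ m≮sum
  m∸sum<x : m ∸ sum (reverse xs) < x
  m∸sum<x = subst (λ s → m ∸ s < x) (sym (sum-reverse xs))
    (subst (m ∸ sum xs <_) (ℕ.m+n∸n≡m x (sum xs)) (ℕ.∸-monoˡ-< m<n sum≤m))
  n∸suc-m<x : x + sum xs ∸ suc m < x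
  n∸suc-m<x = subst (x + sum xs ∸ suc m <_) (ℕ.m+n∸n≡m x (sum xs)) (ℕ.∸-monoʳ-< (s≤s sum≤m) m<n)

rankCoeff-rotate : ∀ a as s → 0 < a → suc (length as) ≡ 2 * s →
  ∀ {k} → k ≤ sum (a ∷ as) → rankCoeff (as ∷ʳ a) k ≡ rankCoeff (a ∷ as) (sum (a ∷ as) ∸ k)
rankCoeff-rotate zero       as s ()
rankCoeff-rotate a@(suc _) as s _ even {k} k≤n = begin
  rankCoeff (as ∷ʳ a) k                                ≡⟨ rankCoeff≡idealCount (as ∷ʳ a) k ⟩
  idealCount (orientation (as ∷ʳ a)) k                 ≡⟨ idealCount-cast (sym (sum-↭ (∷↭∷ʳ a as))) (up? (as ∷ʳ a)) k ⟩
  idealCount {n} (up? (as ∷ʳ a) ∘ toℕ) k               ≡⟨ idealCount-cong rotated k ⟩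
  idealCount (not ∘ orientation α ∘ nextFⁿ a) k        ≡⟨ idealCount-∁ (orientation α ∘ nextFⁿ a) k≤n ⟩
  idealCount (orientation α ∘ nextFⁿ a) (n ∸ k)        ≡⟨ idealCount-rotateⁿ a (orientation α) (n ∸ k) ⟨
  idealCount (orientation α) (n ∸ k)                   ≡⟨ rankCoeff≡idealCount α (n ∸ k) ⟨
  rankCoeff α (n ∸ k)                                  ∎
  where
  α = a ∷ as
  n = sum α
  rotated : (i : Fin n) → up? (as ∷ʳ a) (toℕ i) ≡ not (orientation α (nextFⁿ a i))
  rotated i = trans (up?-rotate a as {s} even (toℕ<n i)) (cong (not ∘ up? α) (sym (toℕ-nextFⁿ a i)))

rankCoeff-reverse : ∀ γ s → length γ ≡ 2 * s → ∀ k → rankCoeff (reverse γ) k ≡ rankCoeff γ k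
rankCoeff-reverse γ s even k = begin
  rankCoeff (reverse γ) k                              ≡⟨ rankCoeff≡idealCount (reverse γ) k ⟩
  idealCount (orientation (reverse γ)) k               ≡⟨ idealCount-cast (sum-reverse γ) (up? (reverse γ)) k ⟩
  idealCount {sum γ} (up? (reverse γ) ∘ toℕ) k        ≡⟨ idealCount-cong reflected k ⟩
  idealCount (not ∘ orientation γ ∘ opposite) k        ≡⟨ idealCount-reflect (orientation γ) k ⟨
  idealCount (orientation γ) k                         ≡⟨ rankCoeff≡idealCount γ k ⟨
  rankCoeff γ k                                        ∎
  where
  reflected : (i : Fin (sum γ)) → up? (reverse γ) (toℕ i) ≡ not (orientation γ (opposite i))
  reflected i = begin
    up? (reverse γ) (toℕ i)                              ≡⟨ up?-reverse γ (toℕ<n i) ⟩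
    not (not^ (length γ) (up? γ (sum γ ∸ suc (toℕ i))))  ≡⟨ cong not (not^-even s _ even) ⟩
    not (up? γ (sum γ ∸ suc (toℕ i)))                    ≡⟨ cong (not ∘ up? γ) (opposite-prop i) ⟨
    not (up? γ (toℕ (opposite i)))                       ∎

replicate-∷ʳ : ∀ n (x : A) → replicate n x ∷ʳ x ≡ x ∷ replicate n x
replicate-∷ʳ zero    x = refl
replicate-∷ʳ (suc n) x = cong (x ∷_) (replicate-∷ʳ n x)

reverse-replicate : ∀ n (x : A) → reverse (replicate n x) ≡ replicate n x
reverse-replicate zero    x = refl
reverse-replicate (suc n) x = begin
  reverse (x ∷ replicate n x)     ≡⟨ unfold-reverse x (replicate n x) ⟩
  reverse (replicate n x) ∷ʳ x    ≡⟨ cong (_∷ʳ x) (reverse-replicate n x) ⟩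
  replicate n x ∷ʳ x              ≡⟨ replicate-∷ʳ n x ⟩
  x ∷ replicate n x               ∎

k∷ones-isSymmetricRank : ∀ k t → 0 < k → IsSymmetricRank (k ∷ replicate (suc (2 * t)) 1)
k∷ones-isSymmetricRank k t 0<k j j≤n = begin
  rankCoeff α j                  ≡⟨ rankCoeff-reverse α (suc t) even j ⟨
  rankCoeff (reverse α) j        ≡⟨ cong (λ γ → rankCoeff γ j) reverse-α ⟩
  rankCoeff (ones ∷ʳ k) j        ≡⟨ rankCoeff-rotate k ones (suc t) 0<k even j≤n ⟩
  rankCoeff α (sum α ∸ j)        ∎
  where
  ones = replicate (suc (2 * t)) 1
  α = k ∷ ones
  even : length α ≡ 2 * suc t
  even = trans (cong suc (length-replicate (suc (2 * t)))) (sym (ℕ.*-suc 2 t))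
  reverse-α : reverse α ≡ ones ∷ʳ k
  reverse-α = trans (unfold-reverse k ones) (cong (_∷ʳ k) (reverse-replicate (suc (2 * t)) 1))

lemma3p1 : ((a : ℕ) (as : List ℕ) (s : ℕ) → All (0 <_) (a ∷ as) → length (a ∷ as) ≡ 2 * s →
             ∀ k → k ≤ sum (a ∷ as) →
             rankCoeff (as ++ a ∷ []) k ≡ rankCoeff (a ∷ as) (sum (a ∷ as) ∸ k))
           × ((k t : ℕ) → 0 < k → IsSymmetricRank (k ∷ replicate (suc (2 * t)) 1))
lemma3p1 = (λ { a as s (0<a ∷ _) even k → rankCoeff-rotate a as s 0<a even }) , k∷ones-isSymmetricRank
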